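{- For all $n\ge k\ge 1$, the hypergraph program $H_{n,k}$ computes $\textsc{Clique}_{n,k}$.
   Context: $\textsc{Clique}_{n,k}$ is the monotone Boolean function of the $n(n-1)/2$ variables $e_{jj'}$, $1\le j<j'\le n$, returning $1$ iff the graph with vertices $\{1,\dots,n\}$ and edges $\{\{j,j'\}\mid e_{jj'}=1\}$ contains a $k$-clique. A hypergraph program (HGP) is a hypergraph whose vertices are labelled with $0$, $1$, variables or negated variables; it computes $f$ if for every input $\vec{\alpha}$, $f(\vec{\alpha})=1$ iff some set of pairwise disjoint hyperedges contains every vertex whose label evaluates to $0$ under $\vec\alpha$. $H_{n,k}$ is the HGP with vertices: $w_{jj'}$ labelled $e_{jj'}$ ($1\le j<j'\le n$); $u_{jj'}$ and $u_{j'j}$ labelled $1$ ($1\le j<j'\le n$); $v_i$ labelled $0$ ($1\le i\le k$); and hyperedges $h^{jj'}=\{w_{jj'},u_{jj'}\}$ and $h^{j'j}=\{w_{jj'},u_{j'j}\}$ ($1\le j<j'\le n$), and $f^{ij}=\{v_i\}\cup\{u_{jj'}\mid j'\ne j,\ 1\le j'\le n\}$ ($1\le i\le k$, $1\le j\le n$). -}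

module Defs where

open import Data.Nat using (ℕ)
open import Data.Fin using (Fin; _<_)
open import Data.Bool using (Bool; true; false; not)
open import Data.Product using (Σ; ∃; _×_; _,_)
open import Data.Sum using (_⊎_)
open import Data.Empty using (⊥)
open import Relation.Binary.PropositionalEquality using (_≡_; _≢_)
open import Function.Definitions using (Injective)

data Label (X : Set) : Set where
  lab0 : Label X
  lab1 : Label X
  pos  : X → Label X
  neg  : X → Label X

evalLabel : {X : Set} → (X → Bool) → Label X → Bool
evalLabel α lab0    = false
evalLabel α lab1    = true
evalLabel α (pos x) = α x
evalLabel α (neg x) = not (α x)

record HGP (X : Set) : Set₁ where
  field
    Vertex : Set
    Edge   : Set
    label  : Vertex → Label X
    _∈ₑ_   : Vertex → Edge → Set

Accepts : {X : Set} → HGP X → (X → Bool) → Set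
Accepts {X} H α =
  Σ (Edge → Bool) λ S →
    (∀ e e' → S e ≡ true → S e' ≡ true → e ≢ e' →
       ∀ x → x ∈ₑ e → x ∈ₑ e' → ⊥)
    × (∀ x → evalLabel α (label x) ≡ false → Σ Edge λ e → S e ≡ true × x ∈ₑ e)
  where open HGP H

-- H computes the Boolean function f (given as a predicate on inputs:
-- f α = 1 iff f α holds).
Computes : {X : Set} → HGP X → ((X → Bool) → Set) → Set
Computes {X} H f = ∀ (α : X → Bool) → (f α → Accepts H α) × (Accepts H α → f α)

EdgeVar : ℕ → Set
EdgeVar n = Σ (Fin n × Fin n) λ { (j , j') → j < j' }

Adj : {n : ℕ} → (EdgeVar n → Bool) → Fin n → Fin n → Set
Adj α a b =
    (Σ (a < b) λ p → α ((a , b) , p) ≡ true)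
  ⊎ (Σ (b < a) λ p → α ((b , a) , p) ≡ true)

Clique : (n k : ℕ) → (EdgeVar n → Bool) → Set
Clique n k α =
  Σ (Fin k → Fin n) λ c →
    Injective _≡_ _≡_ c × (∀ i i' → i ≢ i' → Adj α (c i) (c i'))

-- Ordered pair (j,j') with j ≠ j' is encoded as (a , b , p , d) with
-- a < b and direction d: d = true means (j,j') = (a,b), d = false
-- means (j,j') = (b,a).
data HVertex (n k : ℕ) : Set where
  w : (a b : Fin n) → a < b → HVertex n k
  u : (a b : Fin n) → a < b → Bool → HVertex n k
  v : Fin k → HVertex n k

data HEdge (n k : ℕ) : Set where
  h : (a b : Fin n) → a < b → Bool → HEdge n k
  f : Fin k → Fin n → HEdge n k

HLabel : {n k : ℕ} → HVertex n k → Label (EdgeVar n)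
HLabel (w a b p)   = pos ((a , b) , p)
HLabel (u a b p d) = lab1
HLabel (v i)       = lab0

firstIdx : {n : ℕ} → Fin n → Fin n → Bool → Fin n
firstIdx a b true  = a
firstIdx a b false = b

HMem : {n k : ℕ} → HVertex n k → HEdge n k → Set
-- h^{ab} = {w_{ab}, u_{ab}},  h^{ba} = {w_{ab}, u_{ba}}  (a < b)
HMem (w a b _)    (h a' b' _ _)  = (a ≡ a') × (b ≡ b')
HMem (u a b _ d)  (h a' b' _ d') = (a ≡ a') × (b ≡ b') × (d ≡ d')
-- f^{ij} = {v_i} ∪ {u_{jj'} | j' ≠ j}
HMem (u a b _ d)  (f i j)        = firstIdx a b d ≡ j
HMem (v i)        (f i' j)       = i ≡ i'
HMem _            _              = ⊥

H : (n k : ℕ) → HGP (EdgeVar n)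
H n k = record
  { Vertex = HVertex n k
  ; Edge   = HEdge n k
  ; label  = HLabel
  ; _∈ₑ_   = HMem
  }

-- Conversely, each v_i forces some f^{ij} into
-- the cover; two f's in the same column j share a u-vertex, so i ↦ j is injective, and
-- a non-edge between two chosen columns would force an h-edge clashing with one of them.
module Submission where

open import Defs
open import Data.Nat using (ℕ; _≤_)
open import Data.Fin using (Fin; _<_; inject≤)
open import Data.Fin.Properties using (<-irrelevant; <-cmp; <-asym; <⇒≢; any?; inject≤-injective; _≟_)
open import Data.Bool using (Bool; true; false)
open import Data.Product using (Σ; ∃; _×_; _,_; proj₁; proj₂)
open import Data.Sum using (inj₁; inj₂)
open import Data.Empty using (⊥; ⊥-elim)
open import Relation.Nullary using (Dec; yes; no; does; ¬_)
open import Relation.Nullary.Decidable using (dec-true; _×-dec_)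
open import Relation.Binary.PropositionalEquality using (_≡_; _≢_; refl; sym; trans; cong; subst)
open import Relation.Binary.Definitions using (tri<; tri≈; tri>)
open import Function using (_∘_)
open import Function.Definitions using (Injective)

import Data.Bool.Properties as Bool

does-true : {A : Set} (a? : Dec A) → does a? ≡ true → A
does-true (yes a) _ = a

nonEdge⇒¬Adj : {n : ℕ} {α : EdgeVar n → Bool} {a b : Fin n} (p : a < b) →
               α ((a , b) , p) ≡ false → ¬ Adj α a b
nonEdge⇒¬Adj p αab≡false (inj₁ (q , αab≡true)) with refl ← <-irrelevant q p
  with () ← trans (sym αab≡false) αab≡true
nonEdge⇒¬Adj p _ (inj₂ (q , _)) = <-asym p q

exists-≢ : {n : ℕ} {x y : Fin n} → x ≢ y → (j : Fin n) → ∃ λ j' → j ≢ j'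
exists-≢ {x = x} {y} x≢y j with x ≟ j
... | no x≢j = x , λ j≡x → x≢j (sym j≡x)
... | yes refl = y , x≢y

shared-u : {n k : ℕ} {j j' : Fin n} → j ≢ j' → Σ (HVertex n k) λ x → ∀ i → HMem x (f i j)
shared-u {j = j} {j'} j≢j' with <-cmp j j'
... | tri< j<j' _ _ = u j j' j<j' true , λ _ → refl
... | tri≈ _ j≡j' _ = ⊥-elim (j≢j' j≡j')
... | tri> _ _ j'<j = u j' j j'<j false , λ _ → refl

module CliqueToCover {n k : ℕ} (α : EdgeVar n → Bool) (c : Fin k → Fin n)
  (c-injective : Injective _≡_ _≡_ c) (c-adjacent : ∀ i i' → i ≢ i' → Adj α (c i) (c i')) where

  -- true (selecting h^{ab}) iff a lies outside the clique
  direction : Fin n → Bool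
  direction a with any? (λ i → c i ≟ a)
  ... | yes _ = false
  ... | no _ = true

  Selected : HEdge n k → Set
  Selected (f i j) = c i ≡ j
  Selected (h a b p d) = α ((a , b) , p) ≡ false × d ≡ direction a

  selected? : ∀ e → Dec (Selected e)
  selected? (f i j) = c i ≟ j
  selected? (h a b p d) = (α ((a , b) , p) Bool.≟ false) ×-dec (d Bool.≟ direction a)

  selectedU-outside-clique : ∀ {a b} (p : a < b) → α ((a , b) , p) ≡ false →
                             ∀ i → c i ≢ firstIdx a b (direction a)
  selectedU-outside-clique {a} {b} p αab≡false i with any? (λ i → c i ≟ a)
  ... | no a∉c = λ ci≡a → a∉c (i , ci≡a)
  ... | yes (i' , ci'≡a) = λ where
    refl → nonEdge⇒¬Adj {α = α} p αab≡false
             (subst (λ x → Adj α x (c i)) ci'≡a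
               (c-adjacent i' i λ where refl → <⇒≢ p (sym ci'≡a)))

  h-equal : ∀ {a b p p' d d'} → Selected (h a b p d) → Selected (h a b p' d') →
            _≡_ {A = HEdge n k} (h a b p d) (h a b p' d')
  h-equal {p = p} {p'} (_ , refl) (_ , refl) with refl ← <-irrelevant p p' = refl

  selected-sharing-equal : ∀ {e e'} → Selected e → Selected e' →
                           ∀ x → HMem x e → HMem x e' → e ≡ e'
  selected-sharing-equal {h _ _ _ _} {h _ _ _ _} s s' (w _ _ _) (refl , refl) (refl , refl) = h-equal s s'
  selected-sharing-equal {h _ _ _ _} {h _ _ _ _} s s' (u _ _ _ _) (refl , refl , refl) (refl , refl , refl) =
    h-equal s s'
  selected-sharing-equal {h _ _ p _} {f i _} (αab≡false , refl) refl (u _ _ _ _) (refl , refl , refl) u∈f =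
    ⊥-elim (selectedU-outside-clique p αab≡false i (sym u∈f))
  selected-sharing-equal {f i _} {h _ _ p _} refl (αab≡false , refl) (u _ _ _ _) u∈f (refl , refl , refl) =
    ⊥-elim (selectedU-outside-clique p αab≡false i (sym u∈f))
  selected-sharing-equal {f _ _} {f _ _} ci≡j ci≡j' (v _) refl refl = cong (f _) (trans (sym ci≡j) ci≡j')
  selected-sharing-equal {f _ _} {f _ _} ci≡j ci'≡j (u _ _ _ _) refl refl
    with refl ← c-injective (trans ci≡j (sym ci'≡j)) = refl

  S : HEdge n k → Bool
  S e = does (selected? e)

  covered : ∀ x → evalLabel α (HLabel x) ≡ false → Σ (HEdge n k) λ e → S e ≡ true × HMem x e
  covered (w a b p) αab≡false =
    h a b p (direction a) , dec-true (selected? _) (αab≡false , refl) , refl , refl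
  covered (v i) _ = f i (c i) , dec-true (selected? _) refl , refl

  accepts : Accepts (H n k) α
  accepts = S , disjoint , covered
    where
    disjoint : ∀ e e' → S e ≡ true → S e' ≡ true → e ≢ e' → ∀ x → HMem x e → HMem x e' → ⊥
    disjoint e e' s s' e≢e' x x∈e x∈e' =
      e≢e' (selected-sharing-equal (does-true (selected? e) s) (does-true (selected? e') s') x x∈e x∈e')

module CoverToClique {n k : ℕ} (k≤n : k ≤ n) (α : EdgeVar n → Bool) (acc : Accepts (H n k) α) where

  S : HEdge n k → Bool
  S = proj₁ acc

  disjoint : ∀ e e' → S e ≡ true → S e' ≡ true → e ≢ e' → ∀ x → HMem x e → HMem x e' → ⊥
  disjoint = proj₁ (proj₂ acc)

  covered : ∀ x → evalLabel α (HLabel x) ≡ false → Σ (HEdge n k) λ e → S e ≡ true × HMem x e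
  covered = proj₂ (proj₂ acc)

  column : ∀ i → Σ (Fin n) λ j → S (f i j) ≡ true
  column i with covered (v i) refl
  ... | f _ j , s , refl = j , s

  c : Fin k → Fin n
  c i = proj₁ (column i)

  selected-f : ∀ i → S (f i (c i)) ≡ true
  selected-f i = proj₂ (column i)

  c-injective : Injective _≡_ _≡_ c
  c-injective {i} {i'} ci≡ci' with i ≟ i'
  ... | yes i≡i' = i≡i'
  ... | no i≢i' with shared-u (proj₂ (exists-≢ (i≢i' ∘ inject≤-injective k≤n k≤n i i') (c i)))
  ... | x , x∈f = ⊥-elim (disjoint (f i (c i)) (f i' (c i))
                    (selected-f i) (subst (λ j → S (f i' j) ≡ true) (sym ci≡ci') (selected-f i'))
                    (λ where refl → i≢i' refl) x (x∈f i) (x∈f i'))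

  edge : ∀ i i' (p : c i < c i') → α ((c i , c i') , p) ≡ true
  edge i i' p with α ((c i , c i') , p) in αab≡false
  ... | true = refl
  ... | false with covered (w (c i) (c i') p) αab≡false
  ... | h _ _ q true , s , refl , refl =
        ⊥-elim (disjoint _ _ s (selected-f i) (λ ()) (u (c i) (c i') q true) (refl , refl , refl) refl)
  ... | h _ _ q false , s , refl , refl =
        ⊥-elim (disjoint _ _ s (selected-f i') (λ ()) (u (c i) (c i') q false) (refl , refl , refl) refl)

  c-adjacent : ∀ i i' → i ≢ i' → Adj α (c i) (c i')
  c-adjacent i i' i≢i' with <-cmp (c i) (c i')
  ... | tri< p _ _ = inj₁ (p , edge i i' p)
  ... | tri≈ _ ci≡ci' _ = ⊥-elim (i≢i' (c-injective ci≡ci'))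
  ... | tri> _ _ p = inj₂ (p , edge i' i p)

  clique : Clique n k α
  clique = c , c-injective , c-adjacent

theorem14 : (n k : ℕ) → 1 ≤ k → k ≤ n → Computes (H n k) (Clique n k)
theorem14 n k _ k≤n α = clique⇒accepts , CoverToClique.clique k≤n α
  where
  clique⇒accepts : Clique n k α → Accepts (H n k) α
  clique⇒accepts (c , c-injective , c-adjacent) = CliqueToCover.accepts α c c-injective c-adjacent
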